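{- Let $p$ and $q$ be positive coprime integers with $p\geqslant 59\,q$, and let $$Q_{pq}(t)=t^{10}+(2q^2+p^2)(3q^2-2p^2)\,t^8+(q^8+10p^2q^6+4p^4q^4-14p^6q^2+p^8)\,t^6-p^2q^2(q^8-14p^2q^6+4p^4q^4+10p^6q^2+p^8)\,t^4-p^6q^6(q^2+2p^2)(3p^2-2q^2)\,t^2-q^{10}p^{10}.$$ Then the equation $Q_{pq}(t)=0$ has at least one real root $t$ satisfying $$p^2-2qp-2q^2-\frac{9q^3}{p}<t<p^2-2qp-2q^2.$$ -}

module Defs where

open import Data.Nat as ℕ using (ℕ; zero; suc)
open import Data.Integer as ℤ using (ℤ; +_)
open import Data.Rational using (ℚ; _+_; _*_; _-_; _/_; -_; ∣_∣; _≤_; 0ℚ; 1ℚ)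
open import Data.Product using (Σ; ∃; _×_)

infixr 8 _^_
_^_ : ℚ → ℕ → ℚ
x ^ zero  = 1ℚ
x ^ suc k = x * (x ^ k)

ι : ℕ → ℚ
ι n = (+ n) / 1

Qpq : ℕ → ℕ → ℚ → ℚ
Qpq p' q' t =
    t ^ 10
  + ((ι 2 * q ^ 2 + p ^ 2) * (ι 3 * q ^ 2 - ι 2 * p ^ 2)) * t ^ 8
  + (q ^ 8 + ι 10 * p ^ 2 * q ^ 6 + ι 4 * p ^ 4 * q ^ 4 - ι 14 * p ^ 6 * q ^ 2 + p ^ 8) * t ^ 6
  - (p ^ 2 * q ^ 2 * (q ^ 8 - ι 14 * p ^ 2 * q ^ 6 + ι 4 * p ^ 4 * q ^ 4 + ι 10 * p ^ 6 * q ^ 2 + p ^ 8)) * t ^ 4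
  - (p ^ 6 * q ^ 6 * (q ^ 2 + ι 2 * p ^ 2) * (ι 3 * p ^ 2 - ι 2 * q ^ 2)) * t ^ 2
  - q ^ 10 * p ^ 10
  where
    p q : ℚ
    p = ι p'
    q = ι q'

upperB : ℕ → ℕ → ℚ
upperB p' q' = p ^ 2 - ι 2 * q * p - ι 2 * q ^ 2
  where
    p q : ℚ
    p = ι p'
    q = ι q'

-- lower bound  p² − 2qp − 2q² − 9q³/p   (p = 0 case is irrelevant: p > 0 is assumed)
lowerB : ℕ → ℕ → ℚ
lowerB zero    q' = 0ℚ
lowerB (suc k) q' = upperB (suc k) q' - (+ (9 ℕ.* q' ℕ.^ 3)) / suc k

inv : ℕ → ℚ
inv k = (+ 1) / suc k

-- A real number, represented (Bishop style) as a regular Cauchy sequence of rationals.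
IsRegular : (ℕ → ℚ) → Set
IsRegular x = ∀ m n → ∣ x m - x n ∣ ≤ inv m + inv n

-- f(lim x) = 0, for f continuous (a polynomial): f(x n) → 0
TendsToZero : (ℕ → ℚ) → Set
TendsToZero y = ∀ k → ∃ λ N → ∀ n → N ℕ.≤ n → ∣ y n ∣ ≤ inv k

-- a < lim x < b  (strictly): the sequence eventually stays a fixed positive distance inside (a , b)
StrictlyBetween : ℚ → ℚ → (ℕ → ℚ) → Set
StrictlyBetween a b x = ∃ λ k → ∃ λ N → ∀ n → N ℕ.≤ n → (a + inv k ≤ x n) × (x n + inv k ≤ b)

HasRealRootBetween : (ℚ → ℚ) → ℚ → ℚ → Set
HasRealRootBetween f a b =
  Σ (ℕ → ℚ) λ x → IsRegular x × TendsToZero (λ n → f (x n)) × StrictlyBetween a b x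

-- Write U = p² − 2qp − 2q² and t_c = U − c q³/p.  The numbers p t_c = p³ − 2qp² − 2q²p − c q³
-- are integers, so p¹⁰ Q(t_c) = F(p t_c, p, q), with F(u, p, q) = p¹⁰ Q(u/p), is an integer
-- polynomial in p and q.  After the substitution p = s + 59q the expansions of p¹⁰ Q(t₆) and
-- −p¹⁰ Q(t₄) in s and q have only nonnegative coefficients, which is checked by computing them;
-- hence Q(t₆) ≥ 0 ≥ Q(t₄) whenever p ≥ 59q.  A polynomial is Lipschitz on a bounded interval, so
-- bisection of [t₆, t₄] yields a regular Cauchy sequence along which Q tends to 0.  Finally
-- t₆ − (U − 9q³/p) = 3q³/p and U − t₄ = 4q³/p are at least 1/p, so the root lies strictly
-- inside the interval of the theorem.
module Submission where

open import Defs
open import Data.Bool.Base using (Bool; true; false; T; _∧_)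
open import Data.Bool.Properties using (T-∧)
open import Data.Fin.Base using (Fin; zero; suc)
open import Data.Integer.Base as ℤ using (ℤ; +_; -[1+_]; 0ℤ; 1ℤ; +≤+)
import Data.Integer.Properties as ℤ
import Data.Integer.Solver as ℤSolver
open import Data.List.Base as List using (List; []; _∷_)
open import Data.Nat.Base as ℕ using (ℕ; zero; suc; z≤n)
import Data.Nat.Properties as ℕ
open import Data.Nat.Coprimality as Coprimality using (Coprime)
open import Data.Product.Base using (∃; _×_; _,_; proj₁; proj₂)
open import Data.Rational.Base as ℚ using (ℚ; mkℚ; 0ℚ; 1ℚ; ½)
import Data.Rational.Properties as ℚ
open import Data.Rational.Solver using (module +-*-Solver)
open import Data.Sum.Base using (inj₁; inj₂)
open import Data.Vec.Base using (Vec; []; _∷_; lookup; map; tabulate)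
open import Data.Vec.Properties using (lookup-map; tabulate-∘; tabulate∘lookup)
open import Function.Bundles using (Equivalence)
open import Relation.Binary.PropositionalEquality
open import Relation.Nullary.Decidable using (yes; no; toWitness)

-- Integer polynomial expressions

record RawℤAlgebra : Set₁ where
  infixl 6 _+_
  infixl 7 _*_
  infix  8 -_
  field
    Carrier : Set
    const   : ℤ → Carrier
    _+_ _*_ : Carrier → Carrier → Carrier
    -_      : Carrier → Carrier

open RawℤAlgebra using (Carrier)

record IsHomomorphism (A B : RawℤAlgebra) (h : Carrier A → Carrier B) : Set where
  private
    module A = RawℤAlgebra A
    module B = RawℤAlgebra B
  field
    const-homo : ∀ z → h (A.const z) ≡ B.const z
    +-homo     : ∀ x y → h (x A.+ y) ≡ h x B.+ h y
    *-homo     : ∀ x y → h (x A.* y) ≡ h x B.* h y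
    -‿homo     : ∀ x → h (A.- x) ≡ B.- h x

infixl 6 _⊕_ _⊖_
infixl 7 _⊗_
infixr 8 _⊛_
infix  8 ⊝_

data Expr (n : ℕ) : Set where
  var     : Fin n → Expr n
  con     : ℤ → Expr n
  _⊕_ _⊗_ : Expr n → Expr n → Expr n
  ⊝_      : Expr n → Expr n

_⊖_ : ∀ {n} → Expr n → Expr n → Expr n
e ⊖ f = e ⊕ ⊝ f

_⊛_ : ∀ {n} → Expr n → ℕ → Expr n
e ⊛ zero  = con 1ℤ
e ⊛ suc k = e ⊗ e ⊛ k

⟦_⟧⟨_⟩ : ∀ {n} → Expr n → (A : RawℤAlgebra) → Vec (Carrier A) n → Carrier A
⟦ var i ⟧⟨ A ⟩ ρ = lookup ρ i
⟦ con z ⟧⟨ A ⟩ ρ = RawℤAlgebra.const A z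
⟦ e ⊕ f ⟧⟨ A ⟩ ρ = RawℤAlgebra._+_ A (⟦ e ⟧⟨ A ⟩ ρ) (⟦ f ⟧⟨ A ⟩ ρ)
⟦ e ⊗ f ⟧⟨ A ⟩ ρ = RawℤAlgebra._*_ A (⟦ e ⟧⟨ A ⟩ ρ) (⟦ f ⟧⟨ A ⟩ ρ)
⟦ ⊝ e   ⟧⟨ A ⟩ ρ = RawℤAlgebra.-_ A (⟦ e ⟧⟨ A ⟩ ρ)

⟦⟧-homo : ∀ {n A B h} → IsHomomorphism A B h →
          (e : Expr n) (ρ : Vec (Carrier A) n) → h (⟦ e ⟧⟨ A ⟩ ρ) ≡ ⟦ e ⟧⟨ B ⟩ (map h ρ)
⟦⟧-homo {h = h} hom (var i) ρ = sym (lookup-map i h ρ)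
⟦⟧-homo hom (con z) ρ = IsHomomorphism.const-homo hom z
⟦⟧-homo {B = B} hom (e ⊕ f) ρ =
  trans (IsHomomorphism.+-homo hom _ _) (cong₂ (RawℤAlgebra._+_ B) (⟦⟧-homo hom e ρ) (⟦⟧-homo hom f ρ))
⟦⟧-homo {B = B} hom (e ⊗ f) ρ =
  trans (IsHomomorphism.*-homo hom _ _) (cong₂ (RawℤAlgebra._*_ B) (⟦⟧-homo hom e ρ) (⟦⟧-homo hom f ρ))
⟦⟧-homo {B = B} hom (⊝ e) ρ =
  trans (IsHomomorphism.-‿homo hom _) (cong (RawℤAlgebra.-_ B) (⟦⟧-homo hom e ρ))

Expr-algebra : ℕ → RawℤAlgebra
Expr-algebra n = record { Carrier = Expr n ; const = con ; _+_ = _⊕_ ; _*_ = _⊗_ ; -_ = ⊝_ }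

_⟪_⟫ : ∀ {m n} → Expr m → Vec (Expr n) m → Expr n
e ⟪ σ ⟫ = ⟦ e ⟧⟨ Expr-algebra _ ⟩ σ

⟦⟪⟫⟧ : ∀ {m n} A (e : Expr m) (σ : Vec (Expr n) m) (ρ : Vec (Carrier A) n) →
       ⟦ e ⟪ σ ⟫ ⟧⟨ A ⟩ ρ ≡ ⟦ e ⟧⟨ A ⟩ (map (λ f → ⟦ f ⟧⟨ A ⟩ ρ) σ)
⟦⟪⟫⟧ A e σ ρ = ⟦⟧-homo evaluation e σ
  where
  evaluation : IsHomomorphism (Expr-algebra _) A (λ f → ⟦ f ⟧⟨ A ⟩ ρ)
  evaluation = record
    { const-homo = λ _ → refl ; +-homo = λ _ _ → refl ; *-homo = λ _ _ → refl ; -‿homo = λ _ → refl }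

ℤ-algebra : RawℤAlgebra
ℤ-algebra = record { Carrier = ℤ ; const = λ z → z ; _+_ = ℤ._+_ ; _*_ = ℤ._*_ ; -_ = ℤ.-_ }

-- Nonnegativity certificates

record Interpretation (Env : Set) (A : RawℤAlgebra) : Set₁ where
  field
    eval                : Carrier A → Env → ℤ
    eval-isHomomorphism : ∀ ρ → IsHomomorphism A ℤ-algebra (λ a → eval a ρ)
    nonNegative         : Carrier A → Bool
    nonNegative-sound   : ∀ a ρ → T (nonNegative a) → 0ℤ ℤ.≤ eval a ρ

  certify : ∀ {n} (e : Expr n) (σ : Vec (Carrier A) n) → T (nonNegative (⟦ e ⟧⟨ A ⟩ σ)) →
            ∀ ρ → 0ℤ ℤ.≤ ⟦ e ⟧⟨ ℤ-algebra ⟩ (map (λ a → eval a ρ) σ)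
  certify e σ check ρ =
    subst (0ℤ ℤ.≤_) (⟦⟧-homo (eval-isHomomorphism ρ) e σ) (nonNegative-sound _ ρ check)

integers : ∀ {Env} → Interpretation Env ℤ-algebra
integers = record
  { eval                = λ z _ → z
  ; eval-isHomomorphism = λ _ → record
      { const-homo = λ _ → refl ; +-homo = λ _ _ → refl ; *-homo = λ _ _ → refl ; -‿homo = λ _ → refl }
  ; nonNegative         = isNonNegative
  ; nonNegative-sound   = isNonNegative-sound
  }
  where
  isNonNegative : ℤ → Bool
  isNonNegative (+ _)    = true
  isNonNegative -[1+ _ ] = false

  isNonNegative-sound : ∀ {Env} z (ρ : Env) → T (isNonNegative z) → 0ℤ ℤ.≤ z
  isNonNegative-sound (+ _) _ _ = +≤+ z≤n

module HornerOperations (A : RawℤAlgebra) where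
  open RawℤAlgebra A hiding (Carrier)

  infixl 6 _⊞_
  infixl 7 _⊠_

  _⊞_ : List (Carrier A) → List (Carrier A) → List (Carrier A)
  []       ⊞ bs       = bs
  (a ∷ as) ⊞ []       = a ∷ as
  (a ∷ as) ⊞ (b ∷ bs) = a + b ∷ as ⊞ bs

  _⊠_ : List (Carrier A) → List (Carrier A) → List (Carrier A)
  []       ⊠ bs = []
  (a ∷ as) ⊠ bs = List.map (a *_) bs ⊞ (const 0ℤ ∷ as ⊠ bs)

  indeterminate : List (Carrier A)
  indeterminate = const 0ℤ ∷ const 1ℤ ∷ []

Horner : RawℤAlgebra → RawℤAlgebra
Horner A = record
  { Carrier = List (Carrier A) ; const = λ z → const z ∷ [] ; _+_ = _⊞_ ; _*_ = _⊠_ ; -_ = List.map -_ }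
  where
  open RawℤAlgebra A hiding (Carrier)
  open HornerOperations A

+*-nonNeg : ∀ m {i} → 0ℤ ℤ.≤ i → 0ℤ ℤ.≤ + m ℤ.* i
+*-nonNeg m {+ n} _ = subst (0ℤ ℤ.≤_) (ℤ.pos-* m n) (+≤+ z≤n)

-- The new variable x ranges over ℕ, so nonnegative coefficients give a nonnegative value.
module _ {Env : Set} {A : RawℤAlgebra} (I : Interpretation Env A) (x : Env → ℕ) where
  open RawℤAlgebra A hiding (Carrier)
  open Interpretation I
  open HornerOperations A
  open ℤSolver.+-*-Solver using (solve; _:=_; _:+_; _:*_; :-_; con)

  ⟦_⟧ᴴ : List (Carrier A) → Env → ℤ
  ⟦ []     ⟧ᴴ ρ = 0ℤ
  ⟦ a ∷ as ⟧ᴴ ρ = eval a ρ ℤ.+ + x ρ ℤ.* ⟦ as ⟧ᴴ ρ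

  module _ (ρ : Env) where
    open IsHomomorphism (eval-isHomomorphism ρ)

    ⊞-homo : ∀ as bs → ⟦ as ⊞ bs ⟧ᴴ ρ ≡ ⟦ as ⟧ᴴ ρ ℤ.+ ⟦ bs ⟧ᴴ ρ
    ⊞-homo []       bs       = sym (ℤ.+-identityˡ _)
    ⊞-homo (a ∷ as) []       = sym (ℤ.+-identityʳ _)
    ⊞-homo (a ∷ as) (b ∷ bs) rewrite +-homo a b | ⊞-homo as bs =
      solve 5 (λ a b x r s → a :+ b :+ x :* (r :+ s) := a :+ x :* r :+ (b :+ x :* s))
        refl (eval a ρ) (eval b ρ) (+ x ρ) (⟦ as ⟧ᴴ ρ) (⟦ bs ⟧ᴴ ρ)

    scale-homo : ∀ a bs → ⟦ List.map (a *_) bs ⟧ᴴ ρ ≡ eval a ρ ℤ.* ⟦ bs ⟧ᴴ ρ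
    scale-homo a []       = sym (ℤ.*-zeroʳ (eval a ρ))
    scale-homo a (b ∷ bs) rewrite *-homo a b | scale-homo a bs =
      solve 4 (λ a b x r → a :* b :+ x :* (a :* r) := a :* (b :+ x :* r))
        refl (eval a ρ) (eval b ρ) (+ x ρ) (⟦ bs ⟧ᴴ ρ)

    ⊠-homo : ∀ as bs → ⟦ as ⊠ bs ⟧ᴴ ρ ≡ ⟦ as ⟧ᴴ ρ ℤ.* ⟦ bs ⟧ᴴ ρ
    ⊠-homo []       bs = refl
    ⊠-homo (a ∷ as) bs
      rewrite ⊞-homo (List.map (a *_) bs) (const 0ℤ ∷ as ⊠ bs)
            | scale-homo a bs | const-homo 0ℤ | ⊠-homo as bs =
      solve 4 (λ a x r s → a :* s :+ (con 0ℤ :+ x :* (r :* s)) := (a :+ x :* r) :* s)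
        refl (eval a ρ) (+ x ρ) (⟦ as ⟧ᴴ ρ) (⟦ bs ⟧ᴴ ρ)

    neg-homo : ∀ as → ⟦ List.map -_ as ⟧ᴴ ρ ≡ ℤ.- ⟦ as ⟧ᴴ ρ
    neg-homo []       = refl
    neg-homo (a ∷ as) rewrite -‿homo a | neg-homo as =
      solve 3 (λ a x r → :- a :+ x :* (:- r) := :- (a :+ x :* r)) refl (eval a ρ) (+ x ρ) (⟦ as ⟧ᴴ ρ)

    ⟦constant⟧ᴴ : ∀ a → ⟦ a ∷ [] ⟧ᴴ ρ ≡ eval a ρ
    ⟦constant⟧ᴴ a rewrite ℤ.*-zeroʳ (+ x ρ) = ℤ.+-identityʳ (eval a ρ)

    ⟦indeterminate⟧ᴴ : ⟦ indeterminate ⟧ᴴ ρ ≡ + x ρ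
    ⟦indeterminate⟧ᴴ rewrite const-homo 0ℤ | ⟦constant⟧ᴴ (const 1ℤ) | const-homo 1ℤ =
      trans (ℤ.+-identityˡ _) (ℤ.*-identityʳ (+ x ρ))

  nonNegativeᴴ : List (Carrier A) → Bool
  nonNegativeᴴ []       = true
  nonNegativeᴴ (a ∷ as) = nonNegative a ∧ nonNegativeᴴ as

  nonNegativeᴴ-sound : ∀ as ρ → T (nonNegativeᴴ as) → 0ℤ ℤ.≤ ⟦ as ⟧ᴴ ρ
  nonNegativeᴴ-sound []       ρ _     = ℤ.≤-refl
  nonNegativeᴴ-sound (a ∷ as) ρ check =
    ℤ.+-mono-≤ (nonNegative-sound a ρ (proj₁ both)) (+*-nonNeg (x ρ) (nonNegativeᴴ-sound as ρ (proj₂ both)))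
    where
    both : T (nonNegative a) × T (nonNegativeᴴ as)
    both = Equivalence.to T-∧ check

  horner : Interpretation Env (Horner A)
  horner = record
    { eval                = ⟦_⟧ᴴ
    ; eval-isHomomorphism = λ ρ → record
        { const-homo = λ z → trans (⟦constant⟧ᴴ ρ (const z)) (IsHomomorphism.const-homo (eval-isHomomorphism ρ) z)
        ; +-homo = ⊞-homo ρ ; *-homo = ⊠-homo ρ ; -‿homo = neg-homo ρ }
    ; nonNegative         = nonNegativeᴴ
    ; nonNegative-sound   = nonNegativeᴴ-sound
    }

Bivariate : RawℤAlgebra
Bivariate = Horner (Horner ℤ-algebra)

bivariate : Interpretation (ℕ × ℕ) Bivariate
bivariate = horner (horner integers proj₂) proj₁

open Interpretation bivariate using (nonNegative)

s-var q-var : Carrier Bivariate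
s-var = HornerOperations.indeterminate (Horner ℤ-algebra)
q-var = HornerOperations.indeterminate ℤ-algebra ∷ []

-- The substitution p = s + k q, for which s ≥ 0 describes the cone p ≥ k q.
cone : ℕ → Vec (Carrier Bivariate) 2
cone k = ⟦ var zero ⊕ con (+ k) ⊗ var (suc zero) ⟧⟨ Bivariate ⟩ (s-var ∷ q-var ∷ []) ∷ q-var ∷ []

nonNegative-on-cone : ∀ k (e : Expr 2) → T (nonNegative (⟦ e ⟧⟨ Bivariate ⟩ (cone k))) →
                      ∀ {p q} → k ℕ.* q ℕ.≤ p → 0ℤ ℤ.≤ ⟦ e ⟧⟨ ℤ-algebra ⟩ (+ p ∷ + q ∷ [])
nonNegative-on-cone k e check {p} {q} kq≤p =
  subst (λ ρ → 0ℤ ℤ.≤ ⟦ e ⟧⟨ ℤ-algebra ⟩ ρ) (cong₂ (λ x y → x ∷ y ∷ []) eval-p eval-q)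
        (Interpretation.certify bivariate e (cone k) check (s , q))
  where
  open Interpretation bivariate using (eval; eval-isHomomorphism)
  s : ℕ
  s = p ℕ.∸ k ℕ.* q
  eval-s : eval s-var (s , q) ≡ + s
  eval-s = ⟦indeterminate⟧ᴴ (horner integers proj₂) proj₁ (s , q)
  eval-q : eval q-var (s , q) ≡ + q
  eval-q = trans (⟦constant⟧ᴴ (horner integers proj₂) proj₁ (s , q) (HornerOperations.indeterminate ℤ-algebra))
                 (⟦indeterminate⟧ᴴ integers proj₂ (s , q))
  eval-p : eval (lookup (cone k) zero) (s , q) ≡ + p
  eval-p = begin
    eval (lookup (cone k) zero) (s , q)
      ≡⟨ ⟦⟧-homo (eval-isHomomorphism (s , q)) (var zero ⊕ con (+ k) ⊗ var (suc zero)) (s-var ∷ q-var ∷ []) ⟩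
    eval s-var (s , q) ℤ.+ + k ℤ.* eval q-var (s , q) ≡⟨ cong₂ (λ x y → x ℤ.+ + k ℤ.* y) eval-s eval-q ⟩
    + s ℤ.+ + k ℤ.* + q                                ≡⟨ cong (ℤ._+_ (+ s)) (sym (ℤ.pos-* k q)) ⟩
    + (s ℕ.+ k ℕ.* q)                                  ≡⟨ cong +_ (ℕ.m∸n+n≡m kq≤p) ⟩
    + p                                                ∎
    where open ≡-Reasoning

open import Data.Rational.Base using (_+_; _*_; _-_; -_; _/_; _≤_; ∣_∣)
open +-*-Solver using (Polynomial; prove; solve; _:=_; _:+_; _:*_; _:-_; :-_; con; var; ⟦_⟧↓)
  renaming (⟦_⟧ to ⟦_⟧ₛ)

fromℤ : ℤ → ℚ
fromℤ z = z / 1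

ℚ-algebra : RawℤAlgebra
ℚ-algebra = record { Carrier = ℚ ; const = fromℤ ; _+_ = _+_ ; _*_ = _*_ ; -_ = -_ }

fromℤ≡mkℚ : ∀ z → fromℤ z ≡ mkℚ z 0 (Coprimality.sym (Coprimality.1-coprimeTo ℤ.∣ z ∣))
fromℤ≡mkℚ z = ℚ.↥p/↧p≡p (mkℚ z 0 _)

fromℤ-isHomomorphism : IsHomomorphism ℤ-algebra ℚ-algebra fromℤ
fromℤ-isHomomorphism = record
  { const-homo = λ _ → refl
  ; +-homo     = λ i j → trans (cong fromℤ (cong₂ ℤ._+_ (sym (ℤ.*-identityʳ i)) (sym (ℤ.*-identityʳ j))))
                                (sym (cong₂ _+_ (fromℤ≡mkℚ i) (fromℤ≡mkℚ j)))
  ; *-homo     = λ i j → sym (cong₂ _*_ (fromℤ≡mkℚ i) (fromℤ≡mkℚ j))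
  ; -‿homo     = fromℤ-neg
  }
  where
  -- ℚ negation computes by cases on the sign of the numerator.
  fromℤ-neg : ∀ i → fromℤ (ℤ.- i) ≡ - fromℤ i
  fromℤ-neg i@(+ zero)   = trans (fromℤ≡mkℚ (ℤ.- i)) (cong -_ (sym (fromℤ≡mkℚ i)))
  fromℤ-neg i@(+ suc _)  = trans (fromℤ≡mkℚ (ℤ.- i)) (cong -_ (sym (fromℤ≡mkℚ i)))
  fromℤ-neg i@(-[1+ _ ]) = trans (fromℤ≡mkℚ (ℤ.- i)) (cong -_ (sym (fromℤ≡mkℚ i)))

syntax-algebra : ℕ → RawℤAlgebra
syntax-algebra n = record
  { Carrier = Polynomial n ; const = λ z → con (fromℤ z) ; _+_ = _:+_ ; _*_ = _:*_ ; -_ = :-_ }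

⟦⟧ₛ-isHomomorphism : ∀ {n} (ρ : Vec ℚ n) →
                     IsHomomorphism (syntax-algebra n) ℚ-algebra (λ P → ⟦ P ⟧ₛ ρ)
⟦⟧ₛ-isHomomorphism ρ = record
  { const-homo = λ _ → refl ; +-homo = λ _ _ → refl ; *-homo = λ _ _ → refl ; -‿homo = λ _ → refl }

ℚ-identity : ∀ {n} (e₁ e₂ : Expr n) (ρ : Vec ℚ n) →
             ⟦ ⟦ e₁ ⟧⟨ syntax-algebra n ⟩ (tabulate var) ⟧↓ ρ ≡
             ⟦ ⟦ e₂ ⟧⟨ syntax-algebra n ⟩ (tabulate var) ⟧↓ ρ →
             ⟦ e₁ ⟧⟨ ℚ-algebra ⟩ ρ ≡ ⟦ e₂ ⟧⟨ ℚ-algebra ⟩ ρ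
ℚ-identity {n} e₁ e₂ ρ same-normal-form = begin
  ⟦ e₁ ⟧⟨ ℚ-algebra ⟩ ρ                           ≡⟨ cong ⟦ e₁ ⟧⟨ ℚ-algebra ⟩ vars≡ρ ⟨
  ⟦ e₁ ⟧⟨ ℚ-algebra ⟩ (map (λ P → ⟦ P ⟧ₛ ρ) vars) ≡⟨ ⟦⟧-homo (⟦⟧ₛ-isHomomorphism ρ) e₁ vars ⟨
  ⟦ P₁ ⟧ₛ ρ                                       ≡⟨ prove ρ P₁ P₂ same-normal-form ⟩
  ⟦ P₂ ⟧ₛ ρ                                       ≡⟨ ⟦⟧-homo (⟦⟧ₛ-isHomomorphism ρ) e₂ vars ⟩
  ⟦ e₂ ⟧⟨ ℚ-algebra ⟩ (map (λ P → ⟦ P ⟧ₛ ρ) vars) ≡⟨ cong ⟦ e₂ ⟧⟨ ℚ-algebra ⟩ vars≡ρ ⟩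
  ⟦ e₂ ⟧⟨ ℚ-algebra ⟩ ρ                           ∎
  where
  open ≡-Reasoning
  vars : Vec (Polynomial n) n
  vars = tabulate var
  P₁ P₂ : Polynomial n
  P₁ = ⟦ e₁ ⟧⟨ syntax-algebra n ⟩ vars
  P₂ = ⟦ e₂ ⟧⟨ syntax-algebra n ⟩ vars
  vars≡ρ : map (λ P → ⟦ P ⟧ₛ ρ) vars ≡ ρ
  vars≡ρ = trans (sym (tabulate-∘ (λ P → ⟦ P ⟧ₛ ρ) var)) (tabulate∘lookup ρ)

p≤q⇒0≤q-p : ∀ {p q} → p ≤ q → 0ℚ ≤ q - p
p≤q⇒0≤q-p {p} {q} p≤q = subst (_≤ q - p) (ℚ.+-inverseʳ p) (ℚ.+-monoˡ-≤ (- p) p≤q)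

0≤q-p⇒p≤q : ∀ {p q} → 0ℚ ≤ q - p → p ≤ q
0≤q-p⇒p≤q {p} {q} 0≤q-p =
  subst₂ _≤_ (ℚ.+-identityˡ p) (solve 2 (λ p q → q :- p :+ p := q) refl p q) (ℚ.+-monoˡ-≤ p 0≤q-p)

0≤-p⇒p≤0 : ∀ {p} → 0ℚ ≤ - p → p ≤ 0ℚ
0≤-p⇒p≤0 {p} 0≤-p = subst (_≤ 0ℚ) (solve 1 (λ p → :- (:- p) := p) refl p) (ℚ.neg-antimono-≤ 0≤-p)

p≤∣p∣ : ∀ p → p ≤ ∣ p ∣
p≤∣p∣ p with ℚ.≤-total 0ℚ p
... | inj₁ 0≤p = ℚ.≤-reflexive (sym (ℚ.0≤p⇒∣p∣≡p 0≤p))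
... | inj₂ p≤0 = ℚ.≤-trans p≤0 (ℚ.0≤∣p∣ p)

p≤p+q : ∀ {p q} → 0ℚ ≤ q → p ≤ p + q
p≤p+q {p} {q} 0≤q = subst (_≤ p + q) (ℚ.+-identityʳ p) (ℚ.+-monoʳ-≤ p 0≤q)

p≤q+p : ∀ {p q} → 0ℚ ≤ q → p ≤ q + p
p≤q+p {p} {q} 0≤q = subst (_≤ q + p) (ℚ.+-identityˡ p) (ℚ.+-monoˡ-≤ p 0≤q)

∣p-q∣≡∣q-p∣ : ∀ p q → ∣ p - q ∣ ≡ ∣ q - p ∣
∣p-q∣≡∣q-p∣ p q =
  trans (cong ∣_∣ (solve 2 (λ p q → p :- q := :- (q :- p)) refl p q)) (ℚ.∣-p∣≡∣p∣ (q - p))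

p≤q⇒∣p-q∣≡q-p : ∀ {p q} → p ≤ q → ∣ p - q ∣ ≡ q - p
p≤q⇒∣p-q∣≡q-p {p} {q} p≤q = trans (∣p-q∣≡∣q-p∣ p q) (ℚ.0≤p⇒∣p∣≡p (p≤q⇒0≤q-p p≤q))

nonNeg*nonNeg : ∀ {p q} → 0ℚ ≤ p → 0ℚ ≤ q → 0ℚ ≤ p * q
nonNeg*nonNeg {p} {q} 0≤p 0≤q =
  ℚ.nonNegative⁻¹ _ {{ℚ.nonNeg*nonNeg⇒nonNeg p {{ℚ.nonNegative 0≤p}} q {{ℚ.nonNegative 0≤q}}}}

*-mono-≤-nonNeg : ∀ {p P q Q} → 0ℚ ≤ p → p ≤ P → 0ℚ ≤ q → q ≤ Q → p * q ≤ P * Q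
*-mono-≤-nonNeg {p} {P} {q} {Q} 0≤p p≤P 0≤q q≤Q =
  ℚ.≤-trans (ℚ.*-monoˡ-≤-nonNeg p {{ℚ.nonNegative 0≤p}} q≤Q)
            (ℚ.*-monoʳ-≤-nonNeg Q {{ℚ.nonNegative (ℚ.≤-trans 0≤q q≤Q)}} p≤P)

0≤p*r⇒0≤p : ∀ {p} r .{{_ : ℚ.Positive r}} → 0ℚ ≤ p * r → 0ℚ ≤ p
0≤p*r⇒0≤p {p} r 0≤p*r = ℚ.*-cancelʳ-≤-pos r (subst (_≤ p * r) (sym (ℚ.*-zeroˡ r)) 0≤p*r)

p*r≤0⇒p≤0 : ∀ {p} r .{{_ : ℚ.Positive r}} → p * r ≤ 0ℚ → p ≤ 0ℚ
p*r≤0⇒p≤0 {p} r p*r≤0 = ℚ.*-cancelʳ-≤-pos r (subst (p * r ≤_) (sym (ℚ.*-zeroˡ r)) p*r≤0)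

^-nonNeg : ∀ {p} n → 0ℚ ≤ p → 0ℚ ≤ p ^ n
^-nonNeg zero    _   = ℚ.nonNegative⁻¹ 1ℚ
^-nonNeg (suc n) 0≤p = nonNeg*nonNeg 0≤p (^-nonNeg n 0≤p)

^-positive : ∀ {p} n → ℚ.Positive p → ℚ.Positive (p ^ n)
^-positive         zero    _   = _
^-positive {p} (suc n) p>0 = ℚ.pos*pos⇒pos p {{p>0}} (p ^ n) {{^-positive n p>0}}

^-+ : ∀ p m n → p ^ (m ℕ.+ n) ≡ p ^ m * p ^ n
^-+ p zero    n = sym (ℚ.*-identityˡ _)
^-+ p (suc m) n = trans (cong (p *_) (^-+ p m n)) (sym (ℚ.*-assoc p _ _))

ι-+ : ∀ m n → ι (m ℕ.+ n) ≡ ι m + ι n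
ι-+ m n = IsHomomorphism.+-homo fromℤ-isHomomorphism (+ m) (+ n)

ι-* : ∀ m n → ι (m ℕ.* n) ≡ ι m * ι n
ι-* m n = trans (cong fromℤ (ℤ.pos-* m n)) (IsHomomorphism.*-homo fromℤ-isHomomorphism (+ m) (+ n))

ι-^ : ∀ m n → ι (m ℕ.^ n) ≡ ι m ^ n
ι-^ m zero    = refl
ι-^ m (suc n) = trans (ι-* m (m ℕ.^ n)) (cong (ι m *_) (ι-^ m n))

ι-nonNeg : ∀ n → 0ℚ ≤ ι n
ι-nonNeg n rewrite fromℤ≡mkℚ (+ n) = ℚ.nonNegative⁻¹ _

ι[1+n]-positive : ∀ n → ℚ.Positive (ι (suc n))
ι[1+n]-positive n rewrite fromℤ≡mkℚ (+ suc n) = _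

ι-mono-≤ : ∀ {m n} → m ℕ.≤ n → ι m ≤ ι n
ι-mono-≤ {m} {n} m≤n rewrite fromℤ≡mkℚ (+ m) | fromℤ≡mkℚ (+ n) =
  ℚ.*≤* (subst₂ ℤ._≤_ (sym (ℤ.*-identityʳ (+ m))) (sym (ℤ.*-identityʳ (+ n))) (ℤ.+≤+ m≤n))

fromℤ-nonNeg : ∀ {z} → 0ℤ ℤ.≤ z → 0ℚ ≤ fromℤ z
fromℤ-nonNeg {+ n} _ = ι-nonNeg n

inv≡mkℚ : ∀ n → inv n ≡ mkℚ (+ 1) n (Coprimality.1-coprimeTo (suc n))
inv≡mkℚ n = ℚ.↥p/↧p≡p (mkℚ (+ 1) n _)

inv-nonNeg : ∀ n → 0ℚ ≤ inv n
inv-nonNeg n rewrite inv≡mkℚ n = ℚ.nonNegative⁻¹ _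

ι[1+n]*inv[n]≡1 : ∀ n → ι (suc n) * inv n ≡ 1ℚ
ι[1+n]*inv[n]≡1 n rewrite fromℤ≡mkℚ (+ suc n) | inv≡mkℚ n =
  ℚ.*-inverseʳ (mkℚ (+ suc n) 0 (Coprimality.sym (Coprimality.1-coprimeTo (suc n))))

+m/[1+n]≡ι[m]*inv[n] : ∀ m n → (+ m) / suc n ≡ ι m * inv n
+m/[1+n]≡ι[m]*inv[n] m n = begin
  (+ m) / suc n                 ≡⟨ ℚ./-cong (sym (ℤ.*-identityʳ (+ m))) (sym (ℕ.*-identityˡ (suc n))) ⟩
  (+ m ℤ.* + 1) / (1 ℕ.* suc n) ≡⟨ cong₂ _*_ (fromℤ≡mkℚ (+ m)) (inv≡mkℚ n) ⟨
  ι m * inv n                   ∎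
  where open ≡-Reasoning

x-ι[n]*w+w≤x-ι[m]*w : ∀ x w {m n} → 0ℚ ≤ w → m ℕ.< n → x - ι n * w + w ≤ x - ι m * w
x-ι[n]*w+w≤x-ι[m]*w x w {m} {n} 0≤w m<n = 0≤q-p⇒p≤q (subst (0ℚ ≤_) (sym difference)
  (nonNeg*nonNeg (p≤q⇒0≤q-p (ι-mono-≤ m<n)) 0≤w))
  where
  difference : (x - ι m * w) - (x - ι n * w + w) ≡ (ι n - ι (suc m)) * w
  difference = trans (solve 4 (λ x w a b → (x :- a :* w) :- (x :- b :* w :+ w) := (b :- (con 1ℚ :+ a)) :* w)
                              refl x w (ι m) (ι n))
                     (cong (λ z → (ι n - z) * w) (sym (ι-+ 1 m)))

c*k<d*k : ∀ {c d k} → c ℕ.< d → 0 ℕ.< k → c ℕ.* k ℕ.< d ℕ.* k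
c*k<d*k {c} {d} {k} c<d 0<k = ℕ.≤-trans (ℕ.+-monoˡ-≤ (c ℕ.* k) 0<k) (ℕ.*-monoˡ-≤ k c<d)

0≤½ : 0ℚ ≤ ½
0≤½ = ℚ.nonNegative⁻¹ ½

2^n*½^n≡1 : ∀ n → ι (2 ℕ.^ n) * ½ ^ n ≡ 1ℚ
2^n*½^n≡1 zero    = refl
2^n*½^n≡1 (suc n) = begin
  ι (2 ℕ.* 2 ℕ.^ n) * (½ * ½ ^ n)  ≡⟨ cong (_* (½ * ½ ^ n)) (ι-* 2 (2 ℕ.^ n)) ⟩
  ι 2 * ι (2 ℕ.^ n) * (½ * ½ ^ n)  ≡⟨ solve 4 (λ a b c d → a :* b :* (c :* d) := (a :* c) :* (b :* d))
                                              refl (ι 2) (ι (2 ℕ.^ n)) ½ (½ ^ n) ⟩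
  ι 2 * ½ * (ι (2 ℕ.^ n) * ½ ^ n)  ≡⟨ cong (1ℚ *_) (2^n*½^n≡1 n) ⟩
  1ℚ * 1ℚ                           ∎
  where open ≡-Reasoning

½^n≤1 : ∀ n → ½ ^ n ≤ 1ℚ
½^n≤1 zero    = ℚ.≤-refl
½^n≤1 (suc n) = *-mono-≤-nonNeg 0≤½ (toWitness {a? = ½ ℚ.≤? 1ℚ} _) (^-nonNeg n 0≤½) (½^n≤1 n)

½^-antitone : ∀ {m n} → m ℕ.≤ n → ½ ^ n ≤ ½ ^ m
½^-antitone {m} {n} m≤n = begin
  ½ ^ n                  ≡⟨ cong (½ ^_) (sym (ℕ.m+[n∸m]≡n m≤n)) ⟩
  ½ ^ (m ℕ.+ (n ℕ.∸ m))  ≡⟨ ^-+ ½ m (n ℕ.∸ m) ⟩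
  ½ ^ m * ½ ^ (n ℕ.∸ m)  ≤⟨ ℚ.*-monoˡ-≤-nonNeg (½ ^ m) {{ℚ.nonNegative (^-nonNeg m 0≤½)}}
                                                (½^n≤1 (n ℕ.∸ m)) ⟩
  ½ ^ m * 1ℚ             ≡⟨ ℚ.*-identityʳ (½ ^ m) ⟩
  ½ ^ m                  ∎
  where open ℚ.≤-Reasoning

n<2^n : ∀ n → n ℕ.< 2 ℕ.^ n
n<2^n zero    = ℕ.s≤s z≤n
n<2^n (suc n) = ℕ.≤-trans (ℕ.+-monoʳ-≤ 1 (n<2^n n))
                          (subst (1 ℕ.+ 2 ℕ.^ n ℕ.≤_) (cong (2 ℕ.^ n ℕ.+_) (sym (ℕ.+-identityʳ (2 ℕ.^ n))))
                                 (ℕ.+-monoˡ-≤ (2 ℕ.^ n) (ℕ.m^n>0 2 n)))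

½^n≤inv[n] : ∀ n → ½ ^ n ≤ inv n
½^n≤inv[n] n = begin
  ½ ^ n                          ≡⟨ sym (ℚ.*-identityʳ (½ ^ n)) ⟩
  ½ ^ n * 1ℚ                     ≡⟨ cong (½ ^ n *_) (sym (ι[1+n]*inv[n]≡1 n)) ⟩
  ½ ^ n * (ι (suc n) * inv n)    ≡⟨ solve 3 (λ h x w → h :* (x :* w) := (x :* h) :* w)
                                            refl (½ ^ n) (ι (suc n)) (inv n) ⟩
  (ι (suc n) * ½ ^ n) * inv n    ≤⟨ ℚ.*-monoʳ-≤-nonNeg (inv n) {{ℚ.nonNegative (inv-nonNeg n)}}
                                      (ℚ.*-monoʳ-≤-nonNeg (½ ^ n) {{ℚ.nonNegative (^-nonNeg n 0≤½)}}
                                                          (ι-mono-≤ (n<2^n n))) ⟩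
  (ι (2 ℕ.^ n) * ½ ^ n) * inv n  ≡⟨ cong (_* inv n) (2^n*½^n≡1 n) ⟩
  1ℚ * inv n                     ≡⟨ ℚ.*-identityˡ (inv n) ⟩
  inv n                          ∎
  where open ℚ.≤-Reasoning

archimedean-2^ : ∀ r → ∃ λ K → r ≤ ι (2 ℕ.^ K)
archimedean-2^ r@(mkℚ (+ m) d _) = m , subst (r ≤_) (sym (fromℤ≡mkℚ (+ (2 ℕ.^ m))))
  (ℚ.*≤* (subst₂ ℤ._≤_ (ℤ.pos-* m 1) (ℤ.pos-* (2 ℕ.^ m) (suc d))
    (ℤ.+≤+ (ℕ.≤-trans (ℕ.≤-reflexive (ℕ.*-identityʳ m))
                      (ℕ.≤-trans (ℕ.<⇒≤ (n<2^n m)) (ℕ.m≤m*n (2 ℕ.^ m) (suc d)))))))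
archimedean-2^ r@(mkℚ -[1+ m ] d _) = 0 , ℚ.≤-trans (ℚ.<⇒≤ (ℚ.negative⁻¹ r)) (ι-nonNeg 1)

*½^-shift : ∀ {r K} n → r ≤ ι (2 ℕ.^ K) → r * ½ ^ (n ℕ.+ K) ≤ ½ ^ n
*½^-shift {r} {K} n r≤2^K = begin
  r * ½ ^ (n ℕ.+ K)              ≡⟨ cong (r *_) (^-+ ½ n K) ⟩
  r * (½ ^ n * ½ ^ K)            ≡⟨ solve 3 (λ x y z → x :* (y :* z) := (x :* z) :* y) refl r (½ ^ n) (½ ^ K) ⟩
  (r * ½ ^ K) * ½ ^ n            ≤⟨ ℚ.*-monoʳ-≤-nonNeg (½ ^ n) {{ℚ.nonNegative (^-nonNeg n 0≤½)}}
                                     (ℚ.*-monoʳ-≤-nonNeg (½ ^ K) {{ℚ.nonNegative (^-nonNeg K 0≤½)}} r≤2^K) ⟩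
  (ι (2 ℕ.^ K) * ½ ^ K) * ½ ^ n  ≡⟨ cong (_* ½ ^ n) (2^n*½^n≡1 K) ⟩
  1ℚ * ½ ^ n                     ≡⟨ ℚ.*-identityˡ (½ ^ n) ⟩
  ½ ^ n                          ∎
  where open ℚ.≤-Reasoning

-- Bounded Lipschitz functions on an interval

infix 4 _∈[_,_]
_∈[_,_] : ℚ → ℚ → ℚ → Set
x ∈[ a , b ] = a ≤ x × x ≤ b

∣x∣≤∣a∣+∣b∣ : ∀ {a b x} → x ∈[ a , b ] → ∣ x ∣ ≤ ∣ a ∣ + ∣ b ∣
∣x∣≤∣a∣+∣b∣ {a} {b} {x} (a≤x , x≤b) with ℚ.∣p∣≡p∨∣p∣≡-p x
... | inj₁ ∣x∣≡x = begin
  ∣ x ∣          ≡⟨ ∣x∣≡x ⟩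
  x              ≤⟨ x≤b ⟩
  b              ≤⟨ p≤∣p∣ b ⟩
  ∣ b ∣          ≤⟨ p≤q+p (ℚ.0≤∣p∣ a) ⟩
  ∣ a ∣ + ∣ b ∣  ∎
  where open ℚ.≤-Reasoning
... | inj₂ ∣x∣≡-x = begin
  ∣ x ∣          ≡⟨ ∣x∣≡-x ⟩
  - x            ≤⟨ ℚ.neg-antimono-≤ a≤x ⟩
  - a            ≤⟨ subst (- a ≤_) (ℚ.∣-p∣≡∣p∣ a) (p≤∣p∣ (- a)) ⟩
  ∣ a ∣          ≤⟨ p≤p+q (ℚ.0≤∣p∣ b) ⟩
  ∣ a ∣ + ∣ b ∣  ∎
  where open ℚ.≤-Reasoning

record BoundedLipschitzOn (a b : ℚ) (f : ℚ → ℚ) : Set where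
  field
    bound constant : ℚ
    0≤bound        : 0ℚ ≤ bound
    0≤constant     : 0ℚ ≤ constant
    bounded        : ∀ {x} → x ∈[ a , b ] → ∣ f x ∣ ≤ bound
    lipschitz      : ∀ {x y} → x ∈[ a , b ] → y ∈[ a , b ] → ∣ f x - f y ∣ ≤ constant * ∣ x - y ∣

module _ {a b : ℚ} where
  open BoundedLipschitzOn

  id-boundedLipschitz : BoundedLipschitzOn a b (λ x → x)
  id-boundedLipschitz = record
    { bound = ∣ a ∣ + ∣ b ∣ ; constant = 1ℚ
    ; 0≤bound = ℚ.+-mono-≤ (ℚ.0≤∣p∣ a) (ℚ.0≤∣p∣ b) ; 0≤constant = ℚ.nonNegative⁻¹ 1ℚ
    ; bounded = ∣x∣≤∣a∣+∣b∣
    ; lipschitz = λ _ _ → ℚ.≤-reflexive (sym (ℚ.*-identityˡ _))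
    }

  const-boundedLipschitz : ∀ c → BoundedLipschitzOn a b (λ _ → c)
  const-boundedLipschitz c = record
    { bound = ∣ c ∣ ; constant = 0ℚ
    ; 0≤bound = ℚ.0≤∣p∣ c ; 0≤constant = ℚ.≤-refl
    ; bounded = λ _ → ℚ.≤-refl
    ; lipschitz = λ {x} {y} _ _ → ℚ.≤-reflexive (trans (cong ∣_∣ (ℚ.+-inverseʳ c)) (sym (ℚ.*-zeroˡ ∣ x - y ∣)))
    }

  neg-boundedLipschitz : ∀ {f} → BoundedLipschitzOn a b f → BoundedLipschitzOn a b (λ x → - f x)
  neg-boundedLipschitz {f} F = record
    { bound = bound F ; constant = constant F
    ; 0≤bound = 0≤bound F ; 0≤constant = 0≤constant F
    ; bounded = λ {x} x∈ → subst (_≤ bound F) (sym (ℚ.∣-p∣≡∣p∣ (f x))) (bounded F x∈)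
    ; lipschitz = λ {x} {y} x∈ y∈ →
        subst (_≤ constant F * ∣ x - y ∣)
              (trans (sym (ℚ.∣-p∣≡∣p∣ (f x - f y)))
                     (cong ∣_∣ (solve 2 (λ u v → :- (u :- v) := :- u :- :- v) refl (f x) (f y))))
              (lipschitz F x∈ y∈)
    }

  +-boundedLipschitz : ∀ {f g} → BoundedLipschitzOn a b f → BoundedLipschitzOn a b g →
                       BoundedLipschitzOn a b (λ x → f x + g x)
  +-boundedLipschitz {f} {g} F G = record
    { bound = bound F + bound G ; constant = constant F + constant G
    ; 0≤bound = ℚ.+-mono-≤ (0≤bound F) (0≤bound G) ; 0≤constant = ℚ.+-mono-≤ (0≤constant F) (0≤constant G)
    ; bounded = λ {x} x∈ → ℚ.≤-trans (ℚ.∣p+q∣≤∣p∣+∣q∣ (f x) (g x)) (ℚ.+-mono-≤ (bounded F x∈) (bounded G x∈))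
    ; lipschitz = λ {x} {y} x∈ y∈ → begin
        ∣ f x + g x - (f y + g y) ∣
          ≡⟨ cong ∣_∣ (solve 4 (λ a b c d → a :+ b :- (c :+ d) := (a :- c) :+ (b :- d)) refl (f x) (g x) (f y) (g y)) ⟩
        ∣ (f x - f y) + (g x - g y) ∣
          ≤⟨ ℚ.∣p+q∣≤∣p∣+∣q∣ (f x - f y) (g x - g y) ⟩
        ∣ f x - f y ∣ + ∣ g x - g y ∣
          ≤⟨ ℚ.+-mono-≤ (lipschitz F x∈ y∈) (lipschitz G x∈ y∈) ⟩
        constant F * ∣ x - y ∣ + constant G * ∣ x - y ∣
          ≡⟨ ℚ.*-distribʳ-+ ∣ x - y ∣ (constant F) (constant G) ⟨
        (constant F + constant G) * ∣ x - y ∣ ∎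
    }
    where open ℚ.≤-Reasoning

  *-boundedLipschitz : ∀ {f g} → BoundedLipschitzOn a b f → BoundedLipschitzOn a b g →
                       BoundedLipschitzOn a b (λ x → f x * g x)
  *-boundedLipschitz {f} {g} F G = record
    { bound = bound F * bound G ; constant = bound F * constant G + bound G * constant F
    ; 0≤bound = nonNeg*nonNeg (0≤bound F) (0≤bound G)
    ; 0≤constant = ℚ.+-mono-≤ (nonNeg*nonNeg (0≤bound F) (0≤constant G)) (nonNeg*nonNeg (0≤bound G) (0≤constant F))
    ; bounded = λ {x} x∈ → subst (_≤ bound F * bound G) (sym (ℚ.∣p*q∣≡∣p∣*∣q∣ (f x) (g x)))
        (*-mono-≤-nonNeg (ℚ.0≤∣p∣ _) (bounded F x∈) (ℚ.0≤∣p∣ _) (bounded G x∈))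
    ; lipschitz = λ {x} {y} x∈ y∈ → begin
        ∣ f x * g x - f y * g y ∣
          ≡⟨ cong ∣_∣ (solve 4 (λ a b c d → a :* b :- c :* d := a :* (b :- d) :+ d :* (a :- c))
                             refl (f x) (g x) (f y) (g y)) ⟩
        ∣ f x * (g x - g y) + g y * (f x - f y) ∣
          ≤⟨ ℚ.∣p+q∣≤∣p∣+∣q∣ (f x * (g x - g y)) (g y * (f x - f y)) ⟩
        ∣ f x * (g x - g y) ∣ + ∣ g y * (f x - f y) ∣
          ≡⟨ cong₂ _+_ (ℚ.∣p*q∣≡∣p∣*∣q∣ (f x) _) (ℚ.∣p*q∣≡∣p∣*∣q∣ (g y) _) ⟩
        ∣ f x ∣ * ∣ g x - g y ∣ + ∣ g y ∣ * ∣ f x - f y ∣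
          ≤⟨ ℚ.+-mono-≤ (*-mono-≤-nonNeg (ℚ.0≤∣p∣ _) (bounded F x∈) (ℚ.0≤∣p∣ _) (lipschitz G x∈ y∈))
                        (*-mono-≤-nonNeg (ℚ.0≤∣p∣ _) (bounded G y∈) (ℚ.0≤∣p∣ _) (lipschitz F x∈ y∈)) ⟩
        bound F * (constant G * ∣ x - y ∣) + bound G * (constant F * ∣ x - y ∣)
          ≡⟨ solve 5 (λ m l m′ l′ z → m :* (l :* z) :+ m′ :* (l′ :* z) := (m :* l :+ m′ :* l′) :* z)
                   refl (bound F) (constant G) (bound G) (constant F) ∣ x - y ∣ ⟩
        (bound F * constant G + bound G * constant F) * ∣ x - y ∣ ∎
    }
    where open ℚ.≤-Reasoning

  ⟦⟧-boundedLipschitz : ∀ {n} (e : Expr (suc n)) (ρ : Vec ℚ n) →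
                        BoundedLipschitzOn a b (λ x → ⟦ e ⟧⟨ ℚ-algebra ⟩ (x ∷ ρ))
  ⟦⟧-boundedLipschitz (var zero)    ρ = id-boundedLipschitz
  ⟦⟧-boundedLipschitz (var (suc i)) ρ = const-boundedLipschitz (lookup ρ i)
  ⟦⟧-boundedLipschitz (con z)       ρ = const-boundedLipschitz (fromℤ z)
  ⟦⟧-boundedLipschitz (e ⊕ f)       ρ = +-boundedLipschitz (⟦⟧-boundedLipschitz e ρ) (⟦⟧-boundedLipschitz f ρ)
  ⟦⟧-boundedLipschitz (e ⊗ f)       ρ = *-boundedLipschitz (⟦⟧-boundedLipschitz e ρ) (⟦⟧-boundedLipschitz f ρ)
  ⟦⟧-boundedLipschitz (⊝ e)         ρ = neg-boundedLipschitz (⟦⟧-boundedLipschitz e ρ)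

-- Bisection

record SignChange (f : ℚ → ℚ) (u v : ℚ) : Set where
  field
    u≤v    : u ≤ v
    0≤f[u] : 0ℚ ≤ f u
    f[v]≤0 : f v ≤ 0ℚ

midpoint : ℚ → ℚ → ℚ
midpoint u v = (u + v) * ½

midpoint-u≡half : ∀ u v → midpoint u v - u ≡ (v - u) * ½
midpoint-u≡half = solve 2 (λ u v → (u :+ v) :* con ½ :- u := (v :- u) :* con ½) refl

v-midpoint≡half : ∀ u v → v - midpoint u v ≡ (v - u) * ½
v-midpoint≡half = solve 2 (λ u v → v :- (u :+ v) :* con ½ := (v :- u) :* con ½) refl

module _ {u v : ℚ} (u≤v : u ≤ v) where
  private
    0≤half : 0ℚ ≤ (v - u) * ½
    0≤half = nonNeg*nonNeg (p≤q⇒0≤q-p u≤v) 0≤½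

  u≤midpoint : u ≤ midpoint u v
  u≤midpoint = 0≤q-p⇒p≤q (subst (0ℚ ≤_) (sym (midpoint-u≡half u v)) 0≤half)

  midpoint≤v : midpoint u v ≤ v
  midpoint≤v = 0≤q-p⇒p≤q (subst (0ℚ ≤_) (sym (v-midpoint≡half u v)) 0≤half)

module Bisection (f : ℚ → ℚ) where

  halve : ℚ × ℚ → ℚ × ℚ
  halve (u , v) with 0ℚ ℚ.≤? f (midpoint u v)
  ... | yes _ = midpoint u v , v
  ... | no  _ = u , midpoint u v

  record IsHalf (u v u′ v′ : ℚ) : Set where
    field
      signChange : SignChange f u′ v′
      u≤u′       : u ≤ u′
      v′≤v       : v′ ≤ v
      width      : v′ - u′ ≡ (v - u) * ½

  halve-isHalf : ∀ {u v} → SignChange f u v → IsHalf u v (proj₁ (halve (u , v))) (proj₂ (halve (u , v)))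
  halve-isHalf {u} {v} sc with 0ℚ ℚ.≤? f (midpoint u v)
  ... | yes 0≤f[m] = record
    { signChange = record { u≤v = midpoint≤v u≤v ; 0≤f[u] = 0≤f[m] ; f[v]≤0 = f[v]≤0 }
    ; u≤u′ = u≤midpoint u≤v ; v′≤v = ℚ.≤-refl ; width = v-midpoint≡half u v }
    where open SignChange sc
  ... | no  0≰f[m] = record
    { signChange = record { u≤v = u≤midpoint u≤v ; 0≤f[u] = 0≤f[u] ; f[v]≤0 = ℚ.<⇒≤ (ℚ.≰⇒> 0≰f[m]) }
    ; u≤u′ = ℚ.≤-refl ; v′≤v = midpoint≤v u≤v ; width = midpoint-u≡half u v }
    where open SignChange sc

  module _ {a b : ℚ} (sc : SignChange f a b) where

    interval : ℕ → ℚ × ℚ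
    interval zero    = a , b
    interval (suc n) = halve (interval n)

    lo hi : ℕ → ℚ
    lo n = proj₁ (interval n)
    hi n = proj₂ (interval n)

    interval-signChange : ∀ n → SignChange f (lo n) (hi n)
    interval-isHalf     : ∀ n → IsHalf (lo n) (hi n) (lo (suc n)) (hi (suc n))
    interval-signChange zero    = sc
    interval-signChange (suc n) = IsHalf.signChange (interval-isHalf n)
    interval-isHalf n = halve-isHalf (interval-signChange n)

    interval-width : ∀ n → hi n - lo n ≡ (b - a) * ½ ^ n
    interval-width zero    = sym (ℚ.*-identityʳ (b - a))
    interval-width (suc n) = begin
      hi (suc n) - lo (suc n)    ≡⟨ IsHalf.width (interval-isHalf n) ⟩
      (hi n - lo n) * ½          ≡⟨ cong (_* ½) (interval-width n) ⟩
      (b - a) * ½ ^ n * ½        ≡⟨ solve 3 (λ d h x → d :* x :* h := d :* (h :* x)) refl (b - a) ½ (½ ^ n) ⟩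
      (b - a) * ½ ^ suc n        ∎
      where open ≡-Reasoning

    lo≤hi : ∀ n → lo n ≤ hi n
    lo≤hi n = SignChange.u≤v (interval-signChange n)

    interval-antitone : ∀ {i j} → i ℕ.≤ j → lo i ≤ lo j × hi j ≤ hi i
    interval-antitone {i} {j} i≤j =
      subst (λ m → lo i ≤ lo m × hi m ≤ hi i) (ℕ.m∸n+n≡m i≤j) (nested (j ℕ.∸ i))
      where
      nested : ∀ k → lo i ≤ lo (k ℕ.+ i) × hi (k ℕ.+ i) ≤ hi i
      nested zero    = ℚ.≤-refl , ℚ.≤-refl
      nested (suc k) = ℚ.≤-trans (proj₁ (nested k)) (IsHalf.u≤u′ (interval-isHalf (k ℕ.+ i))) ,
                       ℚ.≤-trans (IsHalf.v′≤v (interval-isHalf (k ℕ.+ i))) (proj₂ (nested k))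

    lo∈[a,b] : ∀ n → lo n ∈[ a , b ]
    lo∈[a,b] n = proj₁ from-start , ℚ.≤-trans (lo≤hi n) (proj₂ from-start)
      where
      from-start : a ≤ lo n × hi n ≤ b
      from-start = interval-antitone {0} {n} z≤n

    hi∈[a,b] : ∀ n → hi n ∈[ a , b ]
    hi∈[a,b] n = ℚ.≤-trans (proj₁ from-start) (lo≤hi n) , proj₂ from-start
      where
      from-start : a ≤ lo n × hi n ≤ b
      from-start = interval-antitone {0} {n} z≤n

    ∣lo-lo∣≤width : ∀ {i j} → i ℕ.≤ j → ∣ lo i - lo j ∣ ≤ (b - a) * ½ ^ i
    ∣lo-lo∣≤width {i} {j} i≤j = begin
      ∣ lo i - lo j ∣    ≡⟨ p≤q⇒∣p-q∣≡q-p (proj₁ (interval-antitone i≤j)) ⟩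
      lo j - lo i        ≤⟨ ℚ.+-monoˡ-≤ (- lo i) (ℚ.≤-trans (lo≤hi j) (proj₂ (interval-antitone i≤j))) ⟩
      hi i - lo i        ≡⟨ interval-width i ⟩
      (b - a) * ½ ^ i    ∎
      where open ℚ.≤-Reasoning

record RootBetween (f : ℚ → ℚ) (a b : ℚ) : Set where
  field
    x           : ℕ → ℚ
    regular     : IsRegular x
    tendsToZero : TendsToZero (λ n → f (x n))
    x∈[a,b]     : ∀ n → x n ∈[ a , b ]

bisection-root : ∀ {f a b} → BoundedLipschitzOn a b f → SignChange f a b → RootBetween f a b
bisection-root {f} {a} {b} F sc = record
  { x = x ; regular = regular ; tendsToZero = tendsToZero ; x∈[a,b] = λ n → lo∈[a,b] sc (n ℕ.+ K) }
  where
  open Bisection f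
  open BoundedLipschitzOn F using (constant; 0≤constant; lipschitz)
  K M : ℕ
  K = proj₁ (archimedean-2^ (b - a))
  M = proj₁ (archimedean-2^ constant)

  -- Shifting by K, where b − a ≤ 2^K, turns the width bound (b − a)/2^m into 1/2^m.
  x : ℕ → ℚ
  x n = lo sc (n ℕ.+ K)

  ∣x-x∣≤½^ : ∀ {m n} → m ℕ.≤ n → ∣ x m - x n ∣ ≤ ½ ^ m
  ∣x-x∣≤½^ {m} m≤n =
    ℚ.≤-trans (∣lo-lo∣≤width sc (ℕ.+-monoˡ-≤ K m≤n)) (*½^-shift m (proj₂ (archimedean-2^ (b - a))))

  regular : IsRegular x
  regular m n with ℕ.≤-total m n
  ... | inj₁ m≤n = ℚ.≤-trans (∣x-x∣≤½^ m≤n) (ℚ.≤-trans (½^n≤inv[n] m) (p≤p+q (inv-nonNeg n)))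
  ... | inj₂ n≤m = subst (_≤ inv m + inv n) (∣p-q∣≡∣q-p∣ (x n) (x m))
                     (ℚ.≤-trans (∣x-x∣≤½^ n≤m) (ℚ.≤-trans (½^n≤inv[n] n) (p≤q+p (inv-nonNeg m))))

  ∣f[lo]∣≤ : ∀ j → ∣ f (lo sc j) ∣ ≤ constant * ((b - a) * ½ ^ j)
  ∣f[lo]∣≤ j = begin
    ∣ f (lo sc j) ∣                   ≡⟨ ℚ.0≤p⇒∣p∣≡p 0≤f[u] ⟩
    f (lo sc j)                       ≤⟨ p≤p+q (ℚ.neg-antimono-≤ f[v]≤0) ⟩
    f (lo sc j) - f (hi sc j)         ≤⟨ p≤∣p∣ _ ⟩
    ∣ f (lo sc j) - f (hi sc j) ∣     ≤⟨ lipschitz (lo∈[a,b] sc j) (hi∈[a,b] sc j) ⟩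
    constant * ∣ lo sc j - hi sc j ∣  ≡⟨ cong (constant *_) (trans (p≤q⇒∣p-q∣≡q-p u≤v) (interval-width sc j)) ⟩
    constant * ((b - a) * ½ ^ j)      ∎
    where
    open ℚ.≤-Reasoning
    open SignChange (interval-signChange sc j)

  tendsToZero : TendsToZero (λ n → f (x n))
  tendsToZero k = k ℕ.+ M , λ n k+M≤n → begin
    ∣ f (x n) ∣                        ≤⟨ ∣f[lo]∣≤ (n ℕ.+ K) ⟩
    constant * ((b - a) * ½ ^ (n ℕ.+ K)) ≤⟨ ℚ.*-monoˡ-≤-nonNeg constant {{ℚ.nonNegative 0≤constant}}
                                             (*½^-shift n (proj₂ (archimedean-2^ (b - a)))) ⟩
    constant * ½ ^ n                   ≤⟨ ℚ.*-monoˡ-≤-nonNeg constant {{ℚ.nonNegative 0≤constant}}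
                                             (½^-antitone k+M≤n) ⟩
    constant * ½ ^ (k ℕ.+ M)           ≤⟨ *½^-shift k (proj₂ (archimedean-2^ constant)) ⟩
    ½ ^ k                              ≤⟨ ½^n≤inv[n] k ⟩
    inv k                              ∎
    where open ℚ.≤-Reasoning

-- The polynomial Q_pq

module QExpression where
  t p q : Expr 3
  t = var zero
  p = var (suc zero)
  q = var (suc (suc zero))

  A B C D : Expr 3
  A = (con (+ 2) ⊗ q ⊛ 2 ⊕ p ⊛ 2) ⊗ (con (+ 3) ⊗ q ⊛ 2 ⊖ con (+ 2) ⊗ p ⊛ 2)
  B = q ⊛ 8 ⊕ con (+ 10) ⊗ p ⊛ 2 ⊗ q ⊛ 6 ⊕ con (+ 4) ⊗ p ⊛ 4 ⊗ q ⊛ 4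
        ⊖ con (+ 14) ⊗ p ⊛ 6 ⊗ q ⊛ 2 ⊕ p ⊛ 8
  C = p ⊛ 2 ⊗ q ⊛ 2 ⊗ (q ⊛ 8 ⊖ con (+ 14) ⊗ p ⊛ 2 ⊗ q ⊛ 6 ⊕ con (+ 4) ⊗ p ⊛ 4 ⊗ q ⊛ 4
                          ⊕ con (+ 10) ⊗ p ⊛ 6 ⊗ q ⊛ 2 ⊕ p ⊛ 8)
  D = p ⊛ 6 ⊗ q ⊛ 6 ⊗ (q ⊛ 2 ⊕ con (+ 2) ⊗ p ⊛ 2) ⊗ (con (+ 3) ⊗ p ⊛ 2 ⊖ con (+ 2) ⊗ q ⊛ 2)

  Q F : Expr 3
  Q = t ⊛ 10 ⊕ A ⊗ t ⊛ 8 ⊕ B ⊗ t ⊛ 6 ⊖ C ⊗ t ⊛ 4 ⊖ D ⊗ t ⊛ 2 ⊖ q ⊛ 10 ⊗ p ⊛ 10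
  F = t ⊛ 10 ⊕ A ⊗ p ⊛ 2 ⊗ t ⊛ 8 ⊕ B ⊗ p ⊛ 4 ⊗ t ⊛ 6 ⊖ C ⊗ p ⊛ 6 ⊗ t ⊛ 4 ⊖ D ⊗ p ⊛ 8 ⊗ t ⊛ 2
        ⊖ q ⊛ 10 ⊗ p ⊛ 20

  Q-homogenised : ∀ x y z →
                  ⟦ Q ⟧⟨ ℚ-algebra ⟩ (x ∷ y ∷ z ∷ []) * y ^ 10 ≡ ⟦ F ⟧⟨ ℚ-algebra ⟩ (y * x ∷ y ∷ z ∷ [])
  Q-homogenised x y z = trans (ℚ-identity (Q ⊗ p ⊛ 10) (F ⟪ p ⊗ t ∷ p ∷ q ∷ [] ⟫) (x ∷ y ∷ z ∷ []) refl)
                              (⟦⟪⟫⟧ ℚ-algebra F (p ⊗ t ∷ p ∷ q ∷ []) (x ∷ y ∷ z ∷ []))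

open QExpression using (Q; F; Q-homogenised)

N : ℕ → Expr 2
N c = p ⊛ 3 ⊖ con (+ 2) ⊗ q ⊗ p ⊛ 2 ⊖ con (+ 2) ⊗ q ⊛ 2 ⊗ p ⊖ con (+ c) ⊗ q ⊛ 3
  where
  p q : Expr 2
  p = var zero
  q = var (suc zero)

Q-numerator : ℕ → Expr 2
Q-numerator c = F ⟪ N c ∷ var zero ∷ var (suc zero) ∷ [] ⟫

-- t c p′ q = U − c q³/p for p = suc p′, since inv p′ = 1/p.
t : ℕ → ℕ → ℕ → ℚ
t c p′ q = upperB (suc p′) q - ι c * ι q ^ 3 * inv p′

p*t≡N : ∀ c p′ q → ι (suc p′) * t c p′ q ≡ ⟦ N c ⟧⟨ ℚ-algebra ⟩ (ι (suc p′) ∷ ι q ∷ [])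
p*t≡N c p′ q = begin
  x * t c p′ q                      ≡⟨ ℚ-identity lhs rhs (x ∷ y ∷ w ∷ ι c ∷ []) refl ⟩
  cubic - ι c * y ^ 3 * (x * w)     ≡⟨ cong (λ z → cubic - ι c * y ^ 3 * z) (ι[1+n]*inv[n]≡1 p′) ⟩
  cubic - ι c * y ^ 3 * 1ℚ          ≡⟨ cong (λ z → cubic - z) (ℚ.*-identityʳ (ι c * y ^ 3)) ⟩
  ⟦ N c ⟧⟨ ℚ-algebra ⟩ (x ∷ y ∷ []) ∎
  where
  open ≡-Reasoning
  x y w cubic : ℚ
  x = ι (suc p′)
  y = ι q
  w = inv p′
  cubic = x ^ 3 - ι 2 * y * x ^ 2 - ι 2 * y ^ 2 * x
  P Y W C lhs rhs : Expr 4
  P = var zero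
  Y = var (suc zero)
  W = var (suc (suc zero))
  C = var (suc (suc (suc zero)))
  lhs = P ⊗ (P ⊛ 2 ⊖ con (+ 2) ⊗ Y ⊗ P ⊖ con (+ 2) ⊗ Y ⊛ 2 ⊖ C ⊗ Y ⊛ 3 ⊗ W)
  rhs = P ⊛ 3 ⊖ con (+ 2) ⊗ Y ⊗ P ⊛ 2 ⊖ con (+ 2) ⊗ Y ⊛ 2 ⊗ P ⊖ C ⊗ Y ⊛ 3 ⊗ (P ⊗ W)

Q[t]*p^10≡Q-numerator : ∀ c p′ q → Qpq (suc p′) q (t c p′ q) * ι (suc p′) ^ 10
                                   ≡ ⟦ Q-numerator c ⟧⟨ ℚ-algebra ⟩ (ι (suc p′) ∷ ι q ∷ [])
Q[t]*p^10≡Q-numerator c p′ q = begin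
  Qpq (suc p′) q r * x ^ 10
    ≡⟨ Q-homogenised r x y ⟩
  ⟦ F ⟧⟨ ℚ-algebra ⟩ (x * r ∷ x ∷ y ∷ [])
    ≡⟨ cong (λ u → ⟦ F ⟧⟨ ℚ-algebra ⟩ (u ∷ x ∷ y ∷ [])) (p*t≡N c p′ q) ⟩
  ⟦ F ⟧⟨ ℚ-algebra ⟩ (⟦ N c ⟧⟨ ℚ-algebra ⟩ (x ∷ y ∷ []) ∷ x ∷ y ∷ [])
    ≡⟨ ⟦⟪⟫⟧ ℚ-algebra F (N c ∷ var zero ∷ var (suc zero) ∷ []) (x ∷ y ∷ []) ⟨
  ⟦ Q-numerator c ⟧⟨ ℚ-algebra ⟩ (x ∷ y ∷ []) ∎
  where
  open ≡-Reasoning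
  x y r : ℚ
  x = ι (suc p′)
  y = ι q
  r = t c p′ q

nonNegative-on-coneℚ : ∀ k (e : Expr 2) → T (nonNegative (⟦ e ⟧⟨ Bivariate ⟩ (cone k))) →
                       ∀ {p q} → k ℕ.* q ℕ.≤ p → 0ℚ ≤ ⟦ e ⟧⟨ ℚ-algebra ⟩ (ι p ∷ ι q ∷ [])
nonNegative-on-coneℚ k e check {p} {q} kq≤p =
  subst (0ℚ ≤_) (⟦⟧-homo fromℤ-isHomomorphism e (+ p ∷ + q ∷ []))
        (fromℤ-nonNeg (nonNegative-on-cone k e check kq≤p))

-- Each `_` below is a certificate, checked by computing the expansion of the polynomial in p − 59q and q.
module _ {p′ q : ℕ} (59q≤p : 59 ℕ.* q ℕ.≤ suc p′) where
  private instance
    p^10-positive : ℚ.Positive (ι (suc p′) ^ 10)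
    p^10-positive = ^-positive {ι (suc p′)} 10 (ι[1+n]-positive p′)

  Q[t₆]≥0 : 0ℚ ≤ Qpq (suc p′) q (t 6 p′ q)
  Q[t₆]≥0 = 0≤p*r⇒0≤p {p = Qpq (suc p′) q (t 6 p′ q)} (ι (suc p′) ^ 10)
    (subst (0ℚ ≤_) (sym (Q[t]*p^10≡Q-numerator 6 p′ q))
           (nonNegative-on-coneℚ 59 (Q-numerator 6) _ {suc p′} {q} 59q≤p))

  Q[t₄]≤0 : Qpq (suc p′) q (t 4 p′ q) ≤ 0ℚ
  Q[t₄]≤0 = p*r≤0⇒p≤0 {p = Qpq (suc p′) q (t 4 p′ q)} (ι (suc p′) ^ 10) (0≤-p⇒p≤0
    (subst (λ z → 0ℚ ≤ - z) (sym (Q[t]*p^10≡Q-numerator 4 p′ q))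
           (nonNegative-on-coneℚ 59 (⊝ Q-numerator 4) _ {suc p′} {q} 59q≤p)))

module _ {p′ q : ℕ} (0<q : 0 ℕ.< q) where
  private
    k : ℕ
    k = q ℕ.^ 3
    0<k : 0 ℕ.< k
    0<k = ℕ.m^n>0 q {{ℕ.>-nonZero 0<q}} 3
    U w : ℚ
    U = upperB (suc p′) q
    w = inv p′

    t≡U-ι[c*k]*w : ∀ c → t c p′ q ≡ U - ι (c ℕ.* k) * w
    t≡U-ι[c*k]*w c = cong (λ z → U - z * w) (sym (trans (ι-* c k) (cong (ι c *_) (ι-^ q 3))))

  lowerB+1/p≤t₆ : lowerB (suc p′) q + w ≤ t 6 p′ q
  lowerB+1/p≤t₆ = subst₂ (λ l r → l + w ≤ r)
    (cong (λ z → U - z) (sym (+m/[1+n]≡ι[m]*inv[n] (9 ℕ.* k) p′))) (sym (t≡U-ι[c*k]*w 6))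
    (x-ι[n]*w+w≤x-ι[m]*w U w (inv-nonNeg p′) (c*k<d*k (ℕ.m≤m+n 7 2) 0<k))

  t₄+1/p≤upperB : t 4 p′ q + w ≤ U
  t₄+1/p≤upperB = subst₂ (λ l r → l + w ≤ r)
    (sym (t≡U-ι[c*k]*w 4)) (trans (cong (λ z → U - z) (ℚ.*-zeroˡ w)) (ℚ.+-identityʳ U))
    (x-ι[n]*w+w≤x-ι[m]*w U w (inv-nonNeg p′) (c*k<d*k (ℕ.m≤m+n 1 3) 0<k))

  t₆≤t₄ : t 6 p′ q ≤ t 4 p′ q
  t₆≤t₄ = subst₂ _≤_ (sym (t≡U-ι[c*k]*w 6)) (sym (t≡U-ι[c*k]*w 4))
    (ℚ.≤-trans (p≤p+q (inv-nonNeg p′)) (x-ι[n]*w+w≤x-ι[m]*w U w (inv-nonNeg p′) (c*k<d*k (ℕ.m≤m+n 5 1) 0<k)))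

Qpq-signChange : ∀ {p′ q} → 0 ℕ.< q → 59 ℕ.* q ℕ.≤ suc p′ →
                 SignChange (Qpq (suc p′) q) (t 6 p′ q) (t 4 p′ q)
Qpq-signChange {p′} {q} 0<q 59q≤p = record
  { u≤v    = t₆≤t₄ {p′} 0<q
  ; 0≤f[u] = Q[t₆]≥0 {p′} {q} 59q≤p
  ; f[v]≤0 = Q[t₄]≤0 {p′} {q} 59q≤p
  }

theorem4p2 : (p q : ℕ) → 0 ℕ.< p → 0 ℕ.< q → Coprime p q → 59 ℕ.* q ℕ.≤ p →
    HasRealRootBetween (Qpq p q) (lowerB p q) (upperB p q)
theorem4p2 zero     _ () _ _ _
theorem4p2 (suc p′) q _ 0<q _ 59q≤p = x , regular , tendsToZero , p′ , 0 , λ n _ →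
  ℚ.≤-trans (lowerB+1/p≤t₆ {p′} 0<q) (proj₁ (x∈[a,b] n)) ,
  ℚ.≤-trans (ℚ.+-monoˡ-≤ (inv p′) (proj₂ (x∈[a,b] n))) (t₄+1/p≤upperB {p′} 0<q)
  where
  open RootBetween (bisection-root (⟦⟧-boundedLipschitz Q (ι (suc p′) ∷ ι q ∷ [])) (Qpq-signChange 0<q 59q≤p))
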